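{- Let $X$ be a finite set with $n>1$ elements, let $\mathbf{WO}$ be the set of weak orders on $X$ ordered by inclusion, and let $\mathbf{WO}(2)$ be the set of weak $2$-orders on $X$. For $W\in\mathbf{WO}$ let $J_W=\{U\in\mathbf{WO}(2): W\subseteq U\}$, and let $\mathcal{J}=\{J_W: W\in\mathbf{WO}\}$, ordered by inclusion. Then $W\mapsto J_W$ is a dual isomorphism of posets from $\mathbf{WO}$ onto $\mathcal{J}$: it is a bijection, and for all $W,W'\in\mathbf{WO}$, $W\subseteq W'$ if and only if $J_{W'}\subseteq J_W$.
   Context: A weak order on $X$ is a transitive, strongly complete binary relation on $X$ (for all $x,y$, $(x,y)\in W$ or $(y,x)\in W$). A weak $2$-order is a weak order with exactly two indifference classes (classes of $W\cap W^{ -1}$), i.e. a relation $(A,X\setminus A)=\{(x,y): x\in A\text{ or } y\in X\setminus A\}$ with $\emptyset\neq A\subsetneq X$. -}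

module Defs where

open import Data.Nat using (ℕ)
open import Data.Fin using (Fin)
open import Data.Bool using (Bool; true; false)
open import Data.Product using (Σ; ∃; _×_)
open import Data.Sum using (_⊎_)
open import Relation.Binary.PropositionalEquality using (_≡_)
open import Function.Bundles using (_⇔_)

-- A binary relation on the finite set X = Fin n, given by its (decidable)
-- characteristic function: (x , y) ∈ R  iff  R x y ≡ true.
BRel : ℕ → Set
BRel n = Fin n → Fin n → Bool

_⊆ᴿ_ : ∀ {n} → BRel n → BRel n → Set
R ⊆ᴿ S = ∀ x y → R x y ≡ true → S x y ≡ true

_≐ᴿ_ : ∀ {n} → BRel n → BRel n → Set
R ≐ᴿ S = ∀ x y → R x y ≡ S x y

Transitive : ∀ {n} → BRel n → Set
Transitive W = ∀ x y z → W x y ≡ true → W y z ≡ true → W x z ≡ true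

StronglyComplete : ∀ {n} → BRel n → Set
StronglyComplete W = ∀ x y → W x y ≡ true ⊎ W y x ≡ true

IsWeakOrder : ∀ {n} → BRel n → Set
IsWeakOrder W = Transitive W × StronglyComplete W

-- weak 2-order: U = (A , X ∖ A) = {(x,y) : x ∈ A or y ∈ X ∖ A}
-- for some subset A (characteristic function) with ∅ ≠ A ⊊ X.
IsWeak2Order : ∀ {n} → BRel n → Set
IsWeak2Order {n} U =
  Σ (Fin n → Bool) λ A →
    (∃ λ a → A a ≡ true) × (∃ λ b → A b ≡ false) ×
    (∀ x y → U x y ≡ true ⇔ (A x ≡ true ⊎ A y ≡ false))

J : ∀ {n} → BRel n → BRel n → Set
J W U = IsWeak2Order U × W ⊆ᴿ U

_⊆ᴶ_ : ∀ {n} → (BRel n → Set) → (BRel n → Set) → Set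
P ⊆ᴶ Q = ∀ U → P U → Q U

{-# OPTIONS --safe #-}
module Submission where

open import Defs
open import Data.Nat using (ℕ; _≤_)
open import Data.Product using (_×_; _,_; Σ)
open import Data.Sum using (_⊎_; inj₁; inj₂; [_,_])
open import Data.Bool using (Bool; true; false; not; _∨_)
open import Data.Fin using (Fin)
open import Function.Bundles using (_⇔_; mk⇔; Equivalence)
open import Relation.Binary.PropositionalEquality using (_≡_; refl; sym; trans)

-- A weak order W is the intersection of the weak 2-orders containing it: if
-- (x, y) ∉ W, the cut (A, X ∖ A) at the down-set A = {z : (z, y) ∈ W} contains W
-- by transitivity and omits (x, y), since y ∈ A by reflexivity and x ∉ A.
-- Hence W ⊆ W' can be read off from J_W' ⊆ J_W, and injectivity follows.

cut : ∀ {n} → (Fin n → Bool) → BRel n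
cut A x y = A x ∨ not (A y)

∨-not-true⇔ : ∀ a b → (a ∨ not b ≡ true) ⇔ (a ≡ true ⊎ b ≡ false)
∨-not-true⇔ a b = mk⇔ (to a b) (from a b)
  where
  to : ∀ a b → a ∨ not b ≡ true → a ≡ true ⊎ b ≡ false
  to true  _     _ = inj₁ refl
  to false false _ = inj₂ refl
  from : ∀ a b → a ≡ true ⊎ b ≡ false → a ∨ not b ≡ true
  from true  _     _        = refl
  from false false _        = refl
  from false true  (inj₁ ())
  from false true  (inj₂ ())

cut-isWeak2Order : ∀ {n} (A : Fin n → Bool) {a b : Fin n} →
                   A a ≡ true → A b ≡ false → IsWeak2Order (cut A)
cut-isWeak2Order A {a} {b} Aa Ab =
  A , (a , Aa) , (b , Ab) , λ x y → ∨-not-true⇔ (A x) (A y)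

downCut : ∀ {n} → BRel n → Fin n → BRel n
downCut W y = cut (λ z → W z y)

transitive⇒⊆downCut : ∀ {n} {W : BRel n} → Transitive W → ∀ y → W ⊆ᴿ downCut W y
transitive⇒⊆downCut {W = W} trans-W y a b Wab with W b y in Wby
... | true  = Equivalence.from (∨-not-true⇔ (W a y) true) (inj₁ (trans-W a b y Wab Wby))
... | false = Equivalence.from (∨-not-true⇔ (W a y) false) (inj₂ refl)

downCut-omits : ∀ {n} {W : BRel n} {x y : Fin n} →
                W y y ≡ true → W x y ≡ false → downCut W y x y ≡ false
downCut-omits Wyy Wxy rewrite Wyy | Wxy = refl

stronglyComplete⇒reflexive : ∀ {n} {W : BRel n} → StronglyComplete W → ∀ x → W x x ≡ true
stronglyComplete⇒reflexive total x = [ (λ p → p) , (λ p → p) ] (total x x)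

separate : ∀ {n} {W : BRel n} → IsWeakOrder W → ∀ {x y} → W x y ≡ false →
           Σ (BRel n) λ U → J W U × U x y ≡ false
separate {W = W} (trans-W , total) {x} {y} Wxy =
  downCut W y ,
  (cut-isWeak2Order (λ z → W z y) Wyy Wxy , transitive⇒⊆downCut trans-W y) ,
  downCut-omits {W = W} Wyy Wxy
  where
  Wyy : W y y ≡ true
  Wyy = stronglyComplete⇒reflexive total y

J-antitone : ∀ {n} {W W' : BRel n} → W ⊆ᴿ W' → J W' ⊆ᴶ J W
J-antitone W⊆W' U (weak2-U , W'⊆U) = weak2-U , λ x y Wxy → W'⊆U x y (W⊆W' x y Wxy)

J-reflects-⊆ : ∀ {n} {W W' : BRel n} → IsWeakOrder W' → J W' ⊆ᴶ J W → W ⊆ᴿ W'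
J-reflects-⊆ {W' = W'} wo' JW'⊆JW x y Wxy with W' x y in W'xy
... | true  = refl
... | false with separate wo' W'xy
...   | U , JW'U , Uxy with JW'⊆JW U JW'U
...     | _ , W⊆U with trans (sym (W⊆U x y Wxy)) Uxy
...       | ()

⊆ᴿ-antisym : ∀ {n} {R S : BRel n} → R ⊆ᴿ S → S ⊆ᴿ R → R ≐ᴿ S
⊆ᴿ-antisym {R = R} {S} R⊆S S⊆R x y with R x y in Rxy
... | true  = sym (R⊆S x y Rxy)
... | false with S x y in Sxy
...   | true  = trans (sym Rxy) (S⊆R x y Sxy)
...   | false = refl

theorem4 : (n : ℕ) → 2 ≤ n →
    -- W ↦ J_W is injective on weak orders (hence a bijection WO → 𝒥)
    ((W W' : BRel n) → IsWeakOrder W → IsWeakOrder W' →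
       J W ⊆ᴶ J W' → J W' ⊆ᴶ J W → W ≐ᴿ W')
    ×
    -- and it is order-reversing in both directions
    ((W W' : BRel n) → IsWeakOrder W → IsWeakOrder W' →
       (W ⊆ᴿ W' ⇔ J W' ⊆ᴶ J W))
theorem4 n _ = injective , dualOrderIso
  where
  injective : (W W' : BRel n) → IsWeakOrder W → IsWeakOrder W' →
              J W ⊆ᴶ J W' → J W' ⊆ᴶ J W → W ≐ᴿ W'
  injective W W' wo wo' JW⊆JW' JW'⊆JW =
    ⊆ᴿ-antisym (J-reflects-⊆ wo' JW'⊆JW) (J-reflects-⊆ wo JW⊆JW')
  dualOrderIso : (W W' : BRel n) → IsWeakOrder W → IsWeakOrder W' →
                 (W ⊆ᴿ W' ⇔ J W' ⊆ᴶ J W)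
  dualOrderIso W W' _ wo' = mk⇔ J-antitone (J-reflects-⊆ wo')
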